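{- Every (finite, simple, connected) graph $G$ with $k\geq 2$ leaves (vertices of degree one) satisfies $\beta(G\,\square\,G)\geq k$.
   Context: $d(v,w)$ denotes shortest-path distance. A vertex $x$ resolves $v,w$ if $d(v,x)\neq d(w,x)$; a set resolves a graph if every pair of distinct vertices is resolved by some vertex of the set; $\beta(G)$ is the minimum size of a resolving set. The cartesian product $G\,\square\,H$ has vertex set $V(G)\times V(H)$, with $(a,v)\sim(b,w)$ iff ($a=b$ and $vw\in E(H)$) or ($v=w$ and $ab\in E(G)$). -}

module Defs where

open import Data.Nat using (ℕ; zero; suc; _≤_; _≡ᵇ_)
open import Data.Bool using (Bool; true; false)
open import Data.Fin using (Fin)
open import Data.List using (List; length; filterᵇ; allFin)
open import Data.List.Membership.Propositional using (_∈_)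
open import Data.Product using (_×_; _,_; ∃; Σ)
open import Data.Sum using (_⊎_)
open import Relation.Binary.PropositionalEquality using (_≡_; _≢_)
open import Relation.Nullary using (¬_)

record Graph : Set where
  field
    n     : ℕ
    adj   : Fin n → Fin n → Bool
    sym   : ∀ u v → adj u v ≡ adj v u
    irrefl : ∀ v → adj v v ≡ false

open Graph public

Edge : (G : Graph) → Fin (n G) → Fin (n G) → Set
Edge G u v = adj G u v ≡ true

data Walk {V : Set} (R : V → V → Set) : V → V → ℕ → Set where
  nil  : ∀ {v} → Walk R v v zero
  cons : ∀ {u w v ℓ} → R u w → Walk R w v ℓ → Walk R u v (suc ℓ)

Dist : {V : Set} (R : V → V → Set) → V → V → ℕ → Set
Dist R u v m = Walk R u v m × (∀ ℓ → Walk R u v ℓ → m ≤ ℓ)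

Connected : Graph → Set
Connected G = ∀ u v → ∃ λ ℓ → Walk (Edge G) u v ℓ

degree : (G : Graph) → Fin (n G) → ℕ
degree G v = length (filterᵇ (adj G v) (allFin (n G)))

leaves : Graph → ℕ
leaves G = length (filterᵇ (λ v → degree G v ≡ᵇ 1) (allFin (n G)))

ProdEdge : (G : Graph) → (Fin (n G) × Fin (n G)) → (Fin (n G) × Fin (n G)) → Set
ProdEdge G (a , v) (b , w) = (a ≡ b × Edge G v w) ⊎ (v ≡ w × Edge G a b)

Resolves : {V : Set} (R : V → V → Set) → V → V → V → Set
Resolves R x v w = ∀ m → Dist R v x m → ¬ Dist R w x m

Resolving : {V : Set} (R : V → V → Set) → List V → Set
Resolving {V} R S = ∀ (v w : V) → v ≢ w → ∃ λ x → x ∈ S × Resolves R x v w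

module Submission where

-- If S has fewer elements than G has leaves, some leaf l is the first
-- coordinate of no element of S and some leaf l′ the second coordinate of
-- none. Let p, p′ be their neighbours. A shortest path from a leaf to any
-- other vertex starts with the edge to its neighbour, and distances in G □ G
-- are sums of coordinate distances, so every (x₁ , x₂) ∈ S lies at distance
-- 1 + d(p, x₁) + d(p′, x₂) from both (l , p′) and (p , l′), which are distinct.

open import Defs hiding (sym)
open import Data.Nat using (ℕ; zero; suc; _+_; _≤_; _<_; _≡ᵇ_; s≤s; z≤n)
open import Data.Nat.Properties using (≮⇒≥; <⇒≱; ≡ᵇ⇒≡; +-suc; +-mono-≤; anyUpTo?; module ≤-Reasoning)
open import Data.Nat.Induction using (<-rec)
open import Data.Bool using (Bool; true; T?)
open import Data.Bool.Properties using (T-≡) renaming (_≟_ to _≟ᵇ_)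
open import Data.Fin using (Fin; _≟_)
open import Data.Fin.Properties using (any?)
open import Data.List using (List; []; _∷_; length; filterᵇ; allFin; map)
open import Data.List.Properties using (length-map; length-removeAt′)
open import Data.List.Membership.Propositional using (_∈_; _∉_; find)
open import Data.List.Membership.Propositional.Properties using (∈-filter⁺; ∈-filter⁻; ∈-allFin; ∈-map⁺)
open import Data.List.Relation.Binary.Subset.Propositional using (_⊆_)
open import Data.List.Relation.Unary.Any using (here; there; index; _─_)
open import Data.List.Relation.Unary.All using (All) renaming (lookup to All-lookup)
open import Data.List.Relation.Unary.All.Properties using (¬All⇒Any¬)
open import Data.List.Relation.Unary.Unique.Propositional using (Unique; _∷_)
open import Data.List.Relation.Unary.Unique.Propositional.Properties using (filter⁺; allFin⁺)
open import Data.Empty using (⊥)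
open import Data.Product using (_×_; _,_; ∃; ∃₂; proj₁; proj₂)
open import Data.Sum using (inj₁; inj₂)
open import Function using (_∘_; Equivalence)
open import Relation.Binary using (Decidable; DecidableEquality)
open import Relation.Binary.PropositionalEquality using (_≡_; _≢_; refl; sym; trans; cong; subst)
open import Relation.Nullary using (¬_; Dec; yes; no; contradiction)
open import Relation.Nullary.Decidable using (_×-dec_)

private
  variable
    A V : Set
    R : V → V → Set

Least : (ℕ → Set) → ℕ → Set
Least P m = P m × (∀ k → P k → m ≤ k)

least-exists : {P : ℕ → Set} → (∀ m → Dec (P m)) → ∀ {L} → P L → ∃ (Least P)
least-exists {P} P? = <-rec (λ L → P L → ∃ (Least P)) step _
  where
  step : ∀ L → (∀ {k} → k < L → P k → ∃ (Least P)) → P L → ∃ (Least P)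
  step L shorter⇒least pL with anyUpTo? P? L
  ... | yes (k , k<L , pk) = shorter⇒least k<L pk
  ... | no  ¬shorter       = L , pL , λ k pk → ≮⇒≥ (λ k<L → ¬shorter (k , k<L , pk))

∈-─⁺ : ∀ {x z : A} {ys} (x∈ys : x ∈ ys) → z ∈ ys → z ≢ x → z ∈ (ys ─ x∈ys)
∈-─⁺ (here refl)  (here refl)  z≢x = contradiction refl z≢x
∈-─⁺ (here _)     (there z∈ys) _   = z∈ys
∈-─⁺ (there _)    (here z≡y)   _   = here z≡y
∈-─⁺ (there x∈ys) (there z∈ys) z≢x = there (∈-─⁺ x∈ys z∈ys z≢x)

Unique-⊆⇒length-≤ : ∀ {xs ys : List A} → Unique xs → xs ⊆ ys → length xs ≤ length ys
Unique-⊆⇒length-≤ {xs = []}     _             _     = z≤n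
Unique-⊆⇒length-≤ {xs = x ∷ xs} {ys} (x∉xs ∷ uniq) xs⊆ys = begin
  suc (length xs)          ≤⟨ s≤s (Unique-⊆⇒length-≤ uniq xs⊆ys─x) ⟩
  suc (length (ys ─ x∈ys)) ≡⟨ sym (length-removeAt′ ys (index x∈ys)) ⟩
  length ys                ∎
  where
  open ≤-Reasoning
  x∈ys : x ∈ ys
  x∈ys = xs⊆ys (here refl)
  xs⊆ys─x : xs ⊆ (ys ─ x∈ys)
  xs⊆ys─x z∈xs = ∈-─⁺ x∈ys (xs⊆ys (there z∈xs)) (All-lookup x∉xs z∈xs ∘ sym)

singleton-members : ∀ {xs : List A} → length xs ≡ 1 → ∃ λ p → p ∈ xs × (∀ {w} → w ∈ xs → w ≡ p)
singleton-members {xs = p ∷ []} refl = p , here refl , λ { (here w≡p) → w≡p }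

∃∉-of-length< : DecidableEquality A → {xs ys : List A} → Unique xs → length ys < length xs →
  ∃ λ x → x ∈ xs × x ∉ ys
∃∉-of-length< _≟_ {xs} {ys} uniq ys<xs =
  find (¬All⇒Any¬ (_∈? ys) xs (<⇒≱ ys<xs ∘ Unique-⊆⇒length-≤ uniq ∘ All-lookup))
  where open import Data.List.Membership.DecPropositional _≟_ using (_∈?_)

_++ʷ_ : ∀ {u v w m k} → Walk R u v m → Walk R v w k → Walk R u w (m + k)
nil      ++ʷ q = q
cons e p ++ʷ q = cons e (p ++ʷ q)

walk-map : {W : Set} {R′ : W → W → Set} (f : V → W) → (∀ {u v} → R u v → R′ (f u) (f v)) →
  ∀ {u v m} → Walk R u v m → Walk R′ (f u) (f v) m
walk-map f map-step nil        = nil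
walk-map f map-step (cons e p) = cons (map-step e) (walk-map f map-step p)

module _ {n : ℕ} {R : Fin n → Fin n → Set} (R? : Decidable R) where

  walk? : ∀ m u v → Dec (Walk R u v m)
  walk? zero u v with u ≟ v
  ... | yes refl = yes nil
  ... | no  u≢v  = no λ { nil → u≢v refl }
  walk? (suc m) u v with any? (λ w → R? u w ×-dec walk? m w v)
  ... | yes (w , e , p) = yes (cons e p)
  ... | no  ¬step       = no λ { (cons e p) → ¬step (_ , e , p) }

  walk⇒dist : ∀ {u v L} → Walk R u v L → ∃ (Dist R u v)
  walk⇒dist {u} {v} = least-exists (λ m → walk? m u v)

Pendant : (R : V → V → Set) → V → V → Set
Pendant R l p = R l p × (∀ {w} → R l w → w ≡ p)

pendant-dist : ∀ {l p x m} → Pendant R l p → Dist R p x m → x ≢ l → Dist R l x (suc m)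
pendant-dist {R = R} {l} {p} {x} {m} (e , unique) (q , minimal) x≢l = cons e q , shortest
  where
  shortest : ∀ L → Walk R l x L → suc m ≤ L
  shortest zero    nil          = contradiction refl x≢l
  shortest (suc L) (cons e′ q′) with refl ← unique e′ = s≤s (minimal L q′)

module _ (G : Graph) where

  edge? : Decidable (Edge G)
  edge? u v = adj G u v ≟ᵇ true

  edge⇒≢ : ∀ {u v} → Edge G u v → u ≢ v
  edge⇒≢ {u} e refl with () ← trans (sym (irrefl G u)) e

  connected⇒dist : Connected G → ∀ u v → ∃ (Dist (Edge G) u v)
  connected⇒dist conn u v = walk⇒dist edge? (proj₂ (conn u v))

  walk-□-split : ∀ {a b c d L} → Walk (ProdEdge G) (a , b) (c , d) L →
    ∃₂ λ L₁ L₂ → L₁ + L₂ ≡ L × Walk (Edge G) a c L₁ × Walk (Edge G) b d L₂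
  walk-□-split nil = 0 , 0 , refl , nil , nil
  walk-□-split (cons (inj₁ (refl , e)) p) with L₁ , L₂ , refl , p₁ , p₂ ← walk-□-split p =
    L₁ , suc L₂ , +-suc L₁ L₂ , p₁ , cons e p₂
  walk-□-split (cons (inj₂ (refl , e)) p) with L₁ , L₂ , refl , p₁ , p₂ ← walk-□-split p =
    suc L₁ , L₂ , refl , cons e p₁ , p₂

  dist-□ : ∀ {a b c d m₁ m₂} → Dist (Edge G) a c m₁ → Dist (Edge G) b d m₂ →
    Dist (ProdEdge G) (a , b) (c , d) (m₁ + m₂)
  dist-□ {a} {b} {c} {d} {m₁} {m₂} (p₁ , minimal₁) (p₂ , minimal₂) =
    walk-map (_, b) (λ e → inj₂ (refl , e)) p₁ ++ʷ walk-map (c ,_) (λ e → inj₁ (refl , e)) p₂ ,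
    shortest
    where
    shortest : ∀ L → Walk (ProdEdge G) (a , b) (c , d) L → m₁ + m₂ ≤ L
    shortest L q with L₁ , L₂ , refl , q₁ , q₂ ← walk-□-split q =
      +-mono-≤ (minimal₁ L₁ q₁) (minimal₂ L₂ q₂)

  swapped-pendants-unresolved : Connected G → ∀ {l p l′ p′ x₁ x₂} →
    Pendant (Edge G) l p → Pendant (Edge G) l′ p′ → x₁ ≢ l → x₂ ≢ l′ →
    ¬ Resolves (ProdEdge G) (x₁ , x₂) (l , p′) (p , l′)
  swapped-pendants-unresolved conn {l} {p} {l′} {p′} {x₁} {x₂} l-p l′-p′ x₁≢l x₂≢l′ resolves =
    let m₁ , d₁ = connected⇒dist conn p x₁
        m₂ , d₂ = connected⇒dist conn p′ x₂
    in resolves (suc m₁ + m₂) (dist-□ (pendant-dist l-p d₁ x₁≢l) d₂)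
         (subst (Dist (ProdEdge G) (p , l′) (x₁ , x₂)) (+-suc m₁ m₂)
           (dist-□ d₁ (pendant-dist l′-p′ d₂ x₂≢l′)))

  isLeaf : Fin (n G) → Bool
  isLeaf v = degree G v ≡ᵇ 1

  leafList : List (Fin (n G))
  leafList = filterᵇ isLeaf (allFin (n G))

  leafList-unique : Unique leafList
  leafList-unique = filter⁺ (T? ∘ isLeaf) (allFin⁺ (n G))

  neighbours : Fin (n G) → List (Fin (n G))
  neighbours u = filterᵇ (adj G u) (allFin (n G))

  ∈-neighbours⁻ : ∀ {u w} → w ∈ neighbours u → Edge G u w
  ∈-neighbours⁻ {u} w∈N = Equivalence.to T-≡ (proj₂ (∈-filter⁻ (T? ∘ adj G u) {xs = allFin (n G)} w∈N))

  ∈-neighbours⁺ : ∀ {u w} → Edge G u w → w ∈ neighbours u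
  ∈-neighbours⁺ {u} {w} e = ∈-filter⁺ (T? ∘ adj G u) (∈-allFin w) (Equivalence.from T-≡ e)

  leaf⇒pendant : ∀ {l} → l ∈ leafList → ∃ (Pendant (Edge G) l)
  leaf⇒pendant {l} l∈leaves =
    let p , p∈N , unique = singleton-members degree≡1
    in p , ∈-neighbours⁻ p∈N , unique ∘ ∈-neighbours⁺
    where
    degree≡1 : length (neighbours l) ≡ 1
    degree≡1 = ≡ᵇ⇒≡ (degree G l) 1 (proj₂ (∈-filter⁻ (T? ∘ isLeaf) {xs = allFin (n G)} l∈leaves))

lemma9p2 : (G : Graph) → Connected G → 2 ≤ leaves G →
    (S : List (Fin (n G) × Fin (n G))) → Resolving (ProdEdge G) S →
    leaves G ≤ length S
lemma9p2 G conn _ S resolving = ≮⇒≥ S-too-small-to-resolve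
  where
  leaf-avoiding : (f : Fin (n G) × Fin (n G) → Fin (n G)) → length S < leaves G →
    ∃ λ l → l ∈ leafList G × ∀ {x} → x ∈ S → f x ≢ l
  leaf-avoiding f S<k =
    let l , l-leaf , l∉fS = ∃∉-of-length< _≟_ (leafList-unique G) fS<k
    in l , l-leaf , λ x∈S fx≡l → l∉fS (subst (_∈ map f S) fx≡l (∈-map⁺ f x∈S))
    where
    fS<k : length (map f S) < leaves G
    fS<k = subst (_< leaves G) (sym (length-map f S)) S<k

  S-too-small-to-resolve : length S < leaves G → ⊥
  S-too-small-to-resolve S<k =
    let l  , l-leaf  , l∉S₁  = leaf-avoiding proj₁ S<k
        l′ , l′-leaf , l′∉S₂ = leaf-avoiding proj₂ S<k
        p  , l-p   = leaf⇒pendant G l-leaf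
        p′ , l′-p′ = leaf⇒pendant G l′-leaf
        x , x∈S , x-resolves = resolving (l , p′) (p , l′) (edge⇒≢ G (proj₁ l-p) ∘ cong proj₁)
    in swapped-pendants-unresolved G conn l-p l′-p′ (l∉S₁ x∈S) (l′∉S₂ x∈S) x-resolves
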